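{- Let $G$ be a connected graph with $\mathrm{diam}(G)=3$, and let $x$ be a vertex of $G$ with $ecc_G(x)=\mathrm{diam}(G)=3$. For $i=1,2,3$ let $n_i=|N_G^i(x)|$, where $N_G^i(x)=\{v\in V(G): dist_G(x,v)=i\}$. If one of the following holds: (i) $n_1=n_2=n_3=1$; (ii) $n_1=n_2=1$ and $n_3\geq 2$; (iii) $n_2=1$ and $n_1,n_3\geq 2$, then $rc(\overline{G})\leq 5$. Furthermore, if $G$ is triangle-free and $\overline{G}$ is connected, then $rc(\overline{G})\leq 5$.
   Context: All graphs are finite, undirected and simple. For an edge-coloring $c:E(H)\to\{1,\dots,k\}$ (adjacent edges may receive the same color), a path is rainbow if no two of its edges have the same color; $H$ is rainbow connected under $c$ if every two vertices are joined by a rainbow path. The rainbow connection number $rc(H)$ of a nontrivial connected graph $H$ is the minimum $k$ for which such a coloring with $k$ colors exists. $dist_G(u,v)$ is the length of a shortest $u$–$v$ path in $G$, $ecc_G(v)=\max_{y\in V(G)} dist_G(v,y)$, $\mathrm{diam}$ denotes diameter, and $\overline{G}$ the complement of $G$. -}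

module Defs where

open import Data.Nat using (ℕ; zero; suc; _≤_)
open import Data.Fin using (Fin)
open import Data.Fin.Properties using (_≟_)
open import Data.Bool using (Bool; true; false; not; _∧_)
open import Data.List using (List; []; _∷_; length)
open import Data.List.Relation.Unary.Unique.Propositional using (Unique)
open import Data.List.Membership.Propositional using (_∈_)
open import Data.Product using (Σ; ∃; _×_; _,_)
open import Data.Empty using (⊥)
open import Relation.Binary.PropositionalEquality using (_≡_)
open import Relation.Nullary.Decidable using (⌊_⌋)
open import Function.Bundles using (_⇔_)

record Graph (n : ℕ) : Set where
  field
    adj    : Fin n → Fin n → Bool
    adj-sym    : ∀ u v → adj u v ≡ adj v u
    adj-irrefl : ∀ u → adj u u ≡ false
open Graph public

complement : ∀ {n} → Graph n → Graph n
complement {n} G = record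
  { adj = λ u v → not (adj G u v) ∧ not ⌊ u ≟ v ⌋
  ; adj-sym = symC
  ; adj-irrefl = irrC }
  where
  open import Relation.Binary.PropositionalEquality using (refl; sym; cong₂)
  open import Relation.Nullary using (yes; no)
  irrC : ∀ u → (not (adj G u u) ∧ not ⌊ u ≟ u ⌋) ≡ false
  irrC u with u ≟ u
  ... | yes _ = Data.Bool.Properties.∧-zeroʳ (not (adj G u u))
    where import Data.Bool.Properties
  ... | no ¬p with ¬p refl
  ... | ()
  dec-sym : ∀ (u v : Fin n) → ⌊ u ≟ v ⌋ ≡ ⌊ v ≟ u ⌋
  dec-sym u v with u ≟ v | v ≟ u
  ... | yes _ | yes _ = refl
  ... | no _  | no _  = refl
  ... | yes p | no q with q (sym p)
  ... | ()
  dec-sym u v | no q | yes p with q (sym p)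
  ... | ()
  symC : ∀ u v → (not (adj G u v) ∧ not ⌊ u ≟ v ⌋) ≡ (not (adj G v u) ∧ not ⌊ v ≟ u ⌋)
  symC u v = cong₂ (λ a b → not a ∧ not b) (adj-sym G u v) (dec-sym u v)

data Walk {n : ℕ} (G : Graph n) : Fin n → Fin n → Set where
  nil  : ∀ u → Walk G u u
  cons : ∀ {u v w} → adj G u v ≡ true → Walk G v w → Walk G u w

module _ {n : ℕ} {G : Graph n} where
  vertices : ∀ {u w} → Walk G u w → List (Fin n)
  vertices (nil u) = u ∷ []
  vertices (cons {u = u} _ p) = u ∷ vertices p

  len : ∀ {u w} → Walk G u w → ℕ
  len (nil _) = zero
  len (cons _ p) = suc (len p)

  IsPath : ∀ {u w} → Walk G u w → Set
  IsPath p = Unique (vertices p)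

  colors : ∀ {k} → (Fin n → Fin n → Fin k) → ∀ {u w} → Walk G u w → List (Fin k)
  colors c (nil _) = []
  colors c (cons {u = u} {v = v} _ p) = c u v ∷ colors c p

  Rainbow : ∀ {k} → (Fin n → Fin n → Fin k) → ∀ {u w} → Walk G u w → Set
  Rainbow c p = Unique (colors c p)

Connected : ∀ {n} → Graph n → Set
Connected {n} G = ∀ (u v : Fin n) → Σ (Walk G u v) IsPath

Dist : ∀ {n} → Graph n → Fin n → Fin n → ℕ → Set
Dist G u v d =
  Σ (Walk G u v) (λ p → IsPath p × len p ≡ d)
  × (∀ (p : Walk G u v) → IsPath p → d ≤ len p)

Ecc : ∀ {n} → Graph n → Fin n → ℕ → Set
Ecc {n} G v e =
  (∀ (y : Fin n) → ∃ λ d → Dist G v y d × d ≤ e)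
  × (∃ λ (y : Fin n) → Dist G v y e)

Diam : ∀ {n} → Graph n → ℕ → Set
Diam {n} G D =
  (∀ (u v : Fin n) → ∃ λ d → Dist G u v d × d ≤ D)
  × (∃ λ (u : Fin n) → ∃ λ (v : Fin n) → Dist G u v D)

Nbhd : ∀ {n} → Graph n → Fin n → ℕ → Fin n → Set
Nbhd G x i v = Dist G x v i

HasCard : ∀ {n} → (Fin n → Set) → ℕ → Set
HasCard {n} P m =
  Σ (List (Fin n)) λ l → Unique l × (∀ v → (v ∈ l) ⇔ P v) × length l ≡ m

-- an edge-coloring of H with colors {1..k} (encoded as Fin k); the
-- coloring is a symmetric function on pairs, its values on non-edges being irrelevant
EdgeColoring : ∀ {n} → Graph n → ℕ → Set
EdgeColoring {n} H k =
  Σ (Fin n → Fin n → Fin k) λ c → ∀ u v → c u v ≡ c v u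

RainbowConnected : ∀ {n k} (H : Graph n) → EdgeColoring H k → Set
RainbowConnected {n} H (c , _) =
  ∀ (u v : Fin n) → Σ (Walk H u v) λ p → IsPath p × Rainbow c p

RainbowColorable : ∀ {n} → Graph n → ℕ → Set
RainbowColorable H k = Σ (EdgeColoring H k) (RainbowConnected H)

RcAtMost : ∀ {n} → Graph n → ℕ → Set
RcAtMost H r = ∃ λ k → k ≤ r × RainbowColorable H k

TriangleFree : ∀ {n} → Graph n → Set
TriangleFree {n} G = ∀ (a b c : Fin n) →
  adj G a b ≡ true → adj G b c ≡ true → adj G a c ≡ true → ⊥

-- Both parts colour Ḡ through a partition of V(G) into five classes: the colour of an edge
-- depends only on the classes of its ends. In the triangle-free case, with dist(x,z) = 3, the
-- classes are {x}, {z}, N(x), N(z) and the rest; triangle-freeness makes N(x) and N(z) cliques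
-- of Ḡ. When N²(x) = {y} and dist(x,b₁) = 3, the classes are {x}, N(x), {y}, {b₁} and the rest,
-- which lies at distance ≥ 3 from x and is therefore completely joined to N(x) in Ḡ; two
-- neighbours of x are joined through b₁, x and a second vertex at distance 3, which exists
-- when n₃ ≥ 2 and is not needed when n₁ = 1. For every pair of classes one fixed sequence of
-- classes yields a rainbow path of length ≤ 4, so rainbow connectivity reduces to a finite check
-- on class sequences, which is decided by evaluation.
module Submission where

open import Defs
open import Data.Bool using (Bool; true; false)
open import Data.Empty using (⊥-elim)
open import Data.Fin using (Fin; #_)
open import Data.Fin.Properties using (_≟_; all?)
open import Data.List using (List; []; _∷_)
open import Data.List.Relation.Unary.All using (All; []; _∷_) renaming (all? to allList?)
open import Data.List.Relation.Unary.AllPairs using ([]; _∷_)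
open import Data.List.Relation.Unary.Any using (here; there)
open import Data.List.Relation.Unary.Unique.Propositional using (Unique)
open import Data.List.Relation.Unary.Unique.DecPropositional using (unique?)
open import Data.Nat using (ℕ; suc; _≤_; s≤s; z≤n)
open import Data.Nat.Properties using (≤-refl; ≤-antisym)
open import Data.Product using (Σ; ∃; _×_; _,_; proj₁; proj₂)
open import Data.Sum using (_⊎_; inj₁; inj₂)
open import Function using (case_of_)
open import Function.Bundles using (Equivalence)
open import Relation.Binary.PropositionalEquality using (_≡_; _≢_; refl; sym; trans; cong₂; subst)
open import Relation.Nullary using (yes; no; ¬?; does)
open import Relation.Nullary.Decidable
  using (True; False; toWitness; toWitnessFalse; dec-true; dec-false)

RainbowPath : ∀ {n k} → Graph n → (Fin n → Fin n → Fin k) → Fin n → Fin n → Set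
RainbowPath H c u v = Σ (Walk H u v) λ p → IsPath p × Rainbow c p

module _ {n : ℕ} (G : Graph n) where

  adj-flip : ∀ {u v b} → adj G u v ≡ b → adj G v u ≡ b
  adj-flip {u} {v} uv = trans (adj-sym G v u) uv

  triangleFree-nonadj : TriangleFree G → ∀ {w u v} → adj G w u ≡ true → adj G w v ≡ true →
                        adj G u v ≡ false
  triangleFree-nonadj tf {w} {u} {v} wu wv with adj G u v in uv
  ... | false = refl
  ... | true  = ⊥-elim (tf w u v wu uv wv)

  adj⇒≢ : ∀ {u v} → adj G u v ≡ true → u ≢ v
  adj⇒≢ {u} uv refl with () ← trans (sym uv) (adj-irrefl G u)

  complement-adj : ∀ {u v} → u ≢ v → adj G u v ≡ false → adj (complement G) u v ≡ true
  complement-adj {u} {v} u≢v uv with u ≟ v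
  ... | yes u≡v = ⊥-elim (u≢v u≡v)
  ... | no _    rewrite uv = refl

  module _ {k : ℕ} {c : Fin n → Fin n → Fin k} where

    trivialPath : ∀ {u} → RainbowPath (complement G) c u u
    trivialPath {u} = nil u , [] ∷ [] , []

    edgePath : ∀ {u v} → u ≢ v → adj G u v ≡ false → RainbowPath (complement G) c u v
    edgePath {v = v} u≢v uv =
      cons (complement-adj u≢v uv) (nil v) , (u≢v ∷ []) ∷ [] ∷ [] , [] ∷ []

    nonadjacentPath : ∀ {u v} → (u ≢ v → adj G u v ≡ false) → RainbowPath (complement G) c u v
    nonadjacentPath {u} {v} uv with u ≟ v
    ... | yes refl = trivialPath
    ... | no u≢v   = edgePath u≢v (uv u≢v)

module _ {n : ℕ} {G : Graph n} where

  dist-suc⇒≢ : ∀ {u v d} → Dist G u v (suc d) → u ≢ v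
  dist-suc⇒≢ (_ , shortest) refl with () ← shortest (nil _) ([] ∷ [])

  dist-≥2⇒nonadj : ∀ {u v d} → Dist G u v (suc (suc d)) → adj G u v ≡ false
  dist-≥2⇒nonadj {u} {v} uv with adj G u v in e
  ... | false = refl
  ... | true with s≤s () ← proj₂ uv (cons e (nil v)) ((dist-suc⇒≢ uv ∷ []) ∷ [] ∷ [])

  dist-one : ∀ {u v} → adj G u v ≡ true → Dist G u v 1
  dist-one {v = v} uv = (cons uv (nil v) , (adj⇒≢ G uv ∷ []) ∷ [] ∷ [] , refl) , shortest
    where
    shortest : (p : Walk G _ v) → IsPath p → 1 ≤ len p
    shortest (nil _)    _ = ⊥-elim (adj⇒≢ G uv refl)
    shortest (cons _ _) _ = s≤s z≤n

  dist-two : ∀ {u a v} → adj G u a ≡ true → adj G a v ≡ true → u ≢ v → adj G u v ≡ false →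
             Dist G u v 2
  dist-two {v = v} ua av u≢v uv =
    (cons ua (cons av (nil v)) , (adj⇒≢ G ua ∷ u≢v ∷ []) ∷ (adj⇒≢ G av ∷ []) ∷ [] ∷ [] , refl) ,
    shortest
    where
    shortest : (p : Walk G _ v) → IsPath p → 2 ≤ len p
    shortest (nil _)              _ = ⊥-elim (u≢v refl)
    shortest (cons uv' (nil _))   _ with () ← trans (sym uv') uv
    shortest (cons _ (cons _ _))  _ = s≤s (s≤s z≤n)

  dist-unique : ∀ {u v d d'} → Dist G u v d → Dist G u v d' → d ≡ d'
  dist-unique ((p , path , refl) , shortest) ((p' , path' , refl) , shortest') =
    ≤-antisym (shortest p' path') (shortest' p path)

  dist-3⇒no-common-neighbour : ∀ {u a v} → Dist G u v 3 → adj G u a ≡ true → adj G a v ≡ false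
  dist-3⇒no-common-neighbour {a = a} {v} uv ua with adj G a v in av
  ... | false = refl
  ... | true with () ← dist-unique uv (dist-two ua av (dist-suc⇒≢ uv) (dist-≥2⇒nonadj uv))

  dist-suc⇒neighbour : ∀ {u v d} → Dist G u v (suc d) → ∃ λ a → adj G u a ≡ true
  dist-suc⇒neighbour ((cons {v = a} ua _ , _ , _) , _) = a , ua

module Routes {n k m : ℕ} (G : Graph n) (tag : Fin n → Fin k) (κ : Fin k → Fin k → Fin m) where

  colouring : Fin n → Fin n → Fin m
  colouring u v = κ (tag u) (tag v)

  headTag : List (Fin k) → Fin k → Fin k
  headTag []      t = t
  headTag (s ∷ _) _ = s

  edgeColours : List (Fin k) → Fin k → List (Fin m)
  edgeColours []       t = []
  edgeColours (s ∷ ts) t = κ s (headTag ts t) ∷ edgeColours ts t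

  edgeColouring : {_ : True (all? λ s → all? λ t → κ s t ≟ κ t s)} → EdgeColoring (complement G) m
  edgeColouring {κ-sym} = colouring , λ u v → toWitness κ-sym (tag u) (tag v)

  apart : ∀ {u v s t} → tag u ≡ s → tag v ≡ t → s ≢ t → u ≢ v
  apart tu tv s≢t refl = s≢t (trans (sym tu) tv)

  -- A walk u ⋯ w in Ḡ, given by the tags of its vertices (ts for all but the last, t for w) and
  -- the non-adjacencies in G of consecutive vertices; distinct consecutive tags make them distinct.
  infixr 5 _⟨_⟩_
  data Route : Fin n → Fin n → List (Fin k) → Fin k → Set where
    [_]   : ∀ {u t} → tag u ≡ t → Route u u [] t
    _⟨_⟩_ : ∀ {u v w s ts t} → tag u ≡ s → adj G u v ≡ false → Route v w ts t →
            {_ : False (s ≟ headTag ts t)} → Route u w (s ∷ ts) t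

  startTag : ∀ {u w ts t} → Route u w ts t → tag u ≡ headTag ts t
  startTag [ tu ]        = tu
  startTag (tu ⟨ _ ⟩ _) = tu

  endTag : ∀ {u w ts t} → Route u w ts t → tag w ≡ t
  endTag [ tw ]        = tw
  endTag (_ ⟨ _ ⟩ r) = endTag r

  walk : ∀ {u w ts t} → Route u w ts t → Walk (complement G) u w
  walk [ _ ] = nil _
  walk ((tu ⟨ uv ⟩ r) {s≢t}) =
    cons (complement-adj G (apart tu (startTag r) (toWitnessFalse s≢t)) uv) (walk r)

  walk-colours : ∀ {u w ts t} (r : Route u w ts t) → colors colouring (walk r) ≡ edgeColours ts t
  walk-colours [ _ ]        = refl
  walk-colours (tu ⟨ _ ⟩ r) = cong₂ _∷_ (cong₂ κ tu (startTag r)) (walk-colours r)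

  fresh : ∀ {u v w s ts t} → tag u ≡ s → All (s ≢_) ts → u ≢ w →
          (r : Route v w ts t) → All (u ≢_) (vertices (walk r))
  fresh tu []          u≢w [ _ ]         = u≢w ∷ []
  fresh tu (s≢s' ∷ ss) u≢w (tv ⟨ _ ⟩ r) = apart tu tv s≢s' ∷ fresh tu ss u≢w r

  walk-isPath : ∀ {u w ts t} (r : Route u w ts t) → Unique ts → All (_≢ t) ts → IsPath (walk r)
  walk-isPath [ _ ]         _            _            = [] ∷ []
  walk-isPath (tu ⟨ _ ⟩ r) (s∉ts ∷ uts) (s≢t ∷ ts≢t) =
    fresh tu s∉ts (apart tu (endTag r) s≢t) r ∷ walk-isPath r uts ts≢t

  rainbow : ∀ {u w ts t} → (r : Route u w ts t) → Unique (edgeColours ts t) →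
            IsPath (walk r) → RainbowPath (complement G) colouring u w
  rainbow r rb path = walk r , path , subst Unique (sym (walk-colours r)) rb

  routePath : ∀ {u w ts t} (r : Route u w ts t) →
              {_ : True (unique? _≟_ ts)} {_ : True (allList? (λ s → ¬? (s ≟ t)) ts)}
              {_ : True (unique? _≟_ (edgeColours ts t))} →
              RainbowPath (complement G) colouring u w
  routePath r {distinct} {apartFromEnd} {rb} =
    rainbow r (toWitness rb) (walk-isPath r (toWitness distinct) (toWitness apartFromEnd))

  -- As routePath, except that the two ends may share a tag provided they are distinct vertices.
  loopPath : ∀ {u w s ts t} → u ≢ w → (r : Route u w (s ∷ ts) t) →
             {_ : True (unique? _≟_ (s ∷ ts))} {_ : True (allList? (λ s → ¬? (s ≟ t)) ts)}
             {_ : True (unique? _≟_ (edgeColours (s ∷ ts) t))} →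
             RainbowPath (complement G) colouring u w
  loopPath u≢w r@(tu ⟨ _ ⟩ r') {distinct} {apartFromEnd} {rb}
    with s∉ts ∷ uts ← toWitness distinct =
    rainbow r (toWitness rb) (fresh tu s∉ts u≢w r' ∷ walk-isPath r' uts (toWitness apartFromEnd))

module _ {n : ℕ} {P : Fin n → Set} where

  card-1-witness : HasCard P 1 → ∃ P
  card-1-witness (y ∷ [] , _ , members , refl) = y , Equivalence.to (members y) (here refl)

  card-1-unique : ∀ {u v} → HasCard P 1 → P u → P v → u ≡ v
  card-1-unique (y ∷ [] , _ , members , refl) pu pv = trans (the-one pu) (sym (the-one pv))
    where
    the-one : ∀ {w} → P w → w ≡ y
    the-one pw with here w≡y ← Equivalence.from (members _) pw = w≡y

  card-≥2-another : ∀ {m} → 2 ≤ m → HasCard P m → ∀ b → ∃ λ b' → P b' × b' ≢ b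
  card-≥2-another (s≤s (s≤s _)) (p ∷ q ∷ _ , (p≢q ∷ _) ∷ _ , members , refl) b with p ≟ b
  ... | yes refl = q , Equivalence.to (members q) (there (here refl)) , λ q≡p → p≢q (sym q≡p)
  ... | no p≢b   = p , Equivalence.to (members p) (here refl) , p≢b

module TriangleFreeColouring {n : ℕ} (G : Graph n) (tf : TriangleFree G)
  {x z : Fin n} (xz : Dist G x z 3) where

  pattern X  = Fin.zero
  pattern Z  = Fin.suc Fin.zero
  pattern A  = Fin.suc (Fin.suc Fin.zero)
  pattern C₁ = Fin.suc (Fin.suc (Fin.suc Fin.zero))
  pattern C₂ = Fin.suc (Fin.suc (Fin.suc (Fin.suc Fin.zero)))

  Rest : Fin n → Set
  Rest u = u ≢ x × u ≢ z × adj G x u ≡ false × adj G z u ≡ false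

  data Class : Fin n → Set where
    isX  : Class x
    isZ  : Class z
    inA  : ∀ {u} → adj G x u ≡ true → Class u
    inC₁ : ∀ {u} → adj G z u ≡ true → Class u
    inC₂ : ∀ {u} → Rest u → Class u

  classify : ∀ u → Class u
  classify u with u ≟ x | u ≟ z | adj G x u in xu | adj G z u in zu
  ... | yes refl | _        | _     | _     = isX
  ... | no u≢x   | yes refl | _     | _     = isZ
  ... | no u≢x   | no u≢z   | true  | _     = inA xu
  ... | no u≢x   | no u≢z   | false | true  = inC₁ zu
  ... | no u≢x   | no u≢z   | false | false = inC₂ (u≢x , u≢z , xu , zu)

  tagOf : ∀ {u} → Class u → Fin 5
  tagOf isX      = X
  tagOf isZ      = Z
  tagOf (inA _)  = A
  tagOf (inC₁ _) = C₁
  tagOf (inC₂ _) = C₂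

  select : (isX isZ inN[x] inN[z] : Bool) → Fin 5
  select true  _    _     _     = X
  select false true _     _     = Z
  select false false true _     = A
  select false false false true  = C₁
  select false false false false = C₂

  -- Not tagOf ∘ classify: Boolean tests let `classified` below be proved by rewriting them.
  tag : Fin n → Fin 5
  tag u = select (does (u ≟ x)) (does (u ≟ z)) (adj G x u) (adj G z u)

  x≁z : adj G x z ≡ false
  x≁z = dist-≥2⇒nonadj xz

  A≁z : ∀ {a} → adj G x a ≡ true → adj G a z ≡ false
  A≁z = dist-3⇒no-common-neighbour xz

  x≁C₁ : ∀ {c} → adj G z c ≡ true → adj G x c ≡ false
  x≁C₁ {c} zc with adj G x c in xc
  ... | false = refl
  ... | true with () ← trans (sym (adj-flip G zc)) (A≁z xc)

  classified : ∀ {u} (c : Class u) → tag u ≡ tagOf c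
  classified isX rewrite dec-true (x ≟ x) refl = refl
  classified isZ
    rewrite dec-false (z ≟ x) (λ z≡x → dist-suc⇒≢ xz (sym z≡x)) | dec-true (z ≟ z) refl = refl
  classified {u} (inA xu)
    rewrite dec-false (u ≟ x) (λ u≡x → adj⇒≢ G xu (sym u≡x))
          | dec-false (u ≟ z) (λ { refl → case trans (sym xu) x≁z of λ () }) | xu = refl
  classified {u} (inC₁ zu)
    rewrite dec-false (u ≟ x) (λ { refl → case trans (sym zu) (adj-flip G x≁z) of λ () })
          | dec-false (u ≟ z) (λ u≡z → adj⇒≢ G zu (sym u≡z)) | x≁C₁ zu | zu = refl
  classified (inC₂ (u≢x , u≢z , xu , zu))
    rewrite dec-false (_ ≟ x) u≢x | dec-false (_ ≟ z) u≢z | xu | zu = refl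

  κ : Fin 5 → Fin 5 → Fin 5
  κ X  Z  = # 0
  κ Z  X  = # 0
  κ X  C₂ = # 1
  κ C₂ X  = # 1
  κ Z  C₂ = # 2
  κ C₂ Z  = # 2
  κ X  C₁ = # 3
  κ C₁ X  = # 3
  κ Z  A  = # 4
  κ A  Z  = # 4
  κ _  _  = # 0   -- never the colour of an edge on a route

  open Routes G tag κ

  tX : tag x ≡ X
  tX = classified isX

  tZ : tag z ≡ Z
  tZ = classified isZ

  betweenRest : ∀ {u v} → Rest u → Rest v → RainbowPath (complement G) colouring u v
  betweenRest {u} {v} ru@(_ , _ , xu , _) rv@(_ , _ , _ , zv) with u ≟ v
  ... | yes refl = trivialPath G
  ... | no u≢v   =
    loopPath u≢v (classified (inC₂ ru) ⟨ adj-flip G xu ⟩ tX ⟨ x≁z ⟩ tZ ⟨ zv ⟩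
                  [ classified (inC₂ rv) ])

  rainbowConnected : ∀ u v → RainbowPath (complement G) colouring u v
  rainbowConnected u v with classify u | classify v
  ... | isX | isX = trivialPath G
  ... | isX | isZ = routePath (tX ⟨ x≁z ⟩ [ tZ ])
  ... | isX | d@(inA xv) = routePath (tX ⟨ x≁z ⟩ tZ ⟨ adj-flip G (A≁z xv) ⟩ [ classified d ])
  ... | isX | d@(inC₁ zv) = routePath (tX ⟨ x≁C₁ zv ⟩ [ classified d ])
  ... | isX | d@(inC₂ (_ , _ , xv , _)) = routePath (tX ⟨ xv ⟩ [ classified d ])
  ... | isZ | isX = routePath (tZ ⟨ adj-flip G x≁z ⟩ [ tX ])
  ... | isZ | isZ = trivialPath G
  ... | isZ | d@(inA xv) = routePath (tZ ⟨ adj-flip G (A≁z xv) ⟩ [ classified d ])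
  ... | isZ | d@(inC₁ zv) = routePath (tZ ⟨ adj-flip G x≁z ⟩ tX ⟨ x≁C₁ zv ⟩ [ classified d ])
  ... | isZ | d@(inC₂ (_ , _ , _ , zv)) = routePath (tZ ⟨ zv ⟩ [ classified d ])
  ... | c@(inA xu) | isX = routePath (classified c ⟨ A≁z xu ⟩ tZ ⟨ adj-flip G x≁z ⟩ [ tX ])
  ... | c@(inA xu) | isZ = routePath (classified c ⟨ A≁z xu ⟩ [ tZ ])
  ... | inA xu | inA xv = nonadjacentPath G (λ _ → triangleFree-nonadj G tf xu xv)
  ... | c@(inA xu) | d@(inC₁ zv) =
    routePath (classified c ⟨ A≁z xu ⟩ tZ ⟨ adj-flip G x≁z ⟩ tX ⟨ x≁C₁ zv ⟩ [ classified d ])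
  ... | c@(inA xu) | d@(inC₂ (_ , _ , _ , zv)) =
    routePath (classified c ⟨ A≁z xu ⟩ tZ ⟨ zv ⟩ [ classified d ])
  ... | c@(inC₁ zu) | isX = routePath (classified c ⟨ adj-flip G (x≁C₁ zu) ⟩ [ tX ])
  ... | c@(inC₁ zu) | isZ = routePath (classified c ⟨ adj-flip G (x≁C₁ zu) ⟩ tX ⟨ x≁z ⟩ [ tZ ])
  ... | c@(inC₁ zu) | d@(inA xv) =
    routePath (classified c ⟨ adj-flip G (x≁C₁ zu) ⟩ tX ⟨ x≁z ⟩ tZ ⟨ adj-flip G (A≁z xv) ⟩
               [ classified d ])
  ... | inC₁ zu | inC₁ zv = nonadjacentPath G (λ _ → triangleFree-nonadj G tf zu zv)
  ... | c@(inC₁ zu) | d@(inC₂ (_ , _ , xv , _)) =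
    routePath (classified c ⟨ adj-flip G (x≁C₁ zu) ⟩ tX ⟨ xv ⟩ [ classified d ])
  ... | c@(inC₂ (_ , _ , xu , _)) | isX = routePath (classified c ⟨ adj-flip G xu ⟩ [ tX ])
  ... | c@(inC₂ (_ , _ , _ , zu)) | isZ = routePath (classified c ⟨ adj-flip G zu ⟩ [ tZ ])
  ... | c@(inC₂ (_ , _ , _ , zu)) | d@(inA xv) =
    routePath (classified c ⟨ adj-flip G zu ⟩ tZ ⟨ adj-flip G (A≁z xv) ⟩ [ classified d ])
  ... | c@(inC₂ (_ , _ , xu , _)) | d@(inC₁ zv) =
    routePath (classified c ⟨ adj-flip G xu ⟩ tX ⟨ x≁C₁ zv ⟩ [ classified d ])
  ... | inC₂ ru | inC₂ rv = betweenRest ru rv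

  rc≤5 : RcAtMost (complement G) 5
  rc≤5 = 5 , ≤-refl , edgeColouring , rainbowConnected

-- Needed only when x has two neighbours, which is why n₁ = 1 or n₃ ≥ 2 is assumed.
FarCompanion : ∀ {n} → Graph n → Fin n → Set
FarCompanion G x = ∀ {a a'} → adj G x a ≡ true → adj G x a' ≡ true → a ≢ a' →
                   ∀ b → ∃ λ b' → Dist G x b' 3 × b' ≢ b

module UniqueSecondNeighbourColouring {n : ℕ} (G : Graph n)
  {x y b₁ : Fin n} (xy : Dist G x y 2) (only-y : ∀ {w} → Dist G x w 2 → w ≡ y) (xb₁ : Dist G x b₁ 3)
  (companion : FarCompanion G x) where

  pattern X  = Fin.zero
  pattern A  = Fin.suc Fin.zero
  pattern Y  = Fin.suc (Fin.suc Fin.zero)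
  pattern B₁ = Fin.suc (Fin.suc (Fin.suc Fin.zero))
  pattern B  = Fin.suc (Fin.suc (Fin.suc (Fin.suc Fin.zero)))

  Beyond : Fin n → Set
  Beyond w = w ≢ x × adj G x w ≡ false × w ≢ y

  data Class : Fin n → Set where
    isX  : Class x
    inA  : ∀ {u} → adj G x u ≡ true → Class u
    isY  : Class y
    isB₁ : Class b₁
    inB  : ∀ {u} → Beyond u → u ≢ b₁ → Class u

  classify : ∀ u → Class u
  classify u with u ≟ x | adj G x u in xu | u ≟ y | u ≟ b₁
  ... | yes refl | _     | _        | _        = isX
  ... | no u≢x   | true  | _        | _        = inA xu
  ... | no u≢x   | false | yes refl | _        = isY
  ... | no u≢x   | false | no u≢y   | yes refl = isB₁
  ... | no u≢x   | false | no u≢y   | no u≢b₁  = inB (u≢x , xu , u≢y) u≢b₁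

  tagOf : ∀ {u} → Class u → Fin 5
  tagOf isX       = X
  tagOf (inA _)   = A
  tagOf isY       = Y
  tagOf isB₁      = B₁
  tagOf (inB _ _) = B

  select : (isX inN[x] isY isB₁ : Bool) → Fin 5
  select true  _     _     _     = X
  select false true  _     _     = A
  select false false true  _     = Y
  select false false false true  = B₁
  select false false false false = B

  tag : Fin n → Fin 5
  tag u = select (does (u ≟ x)) (adj G x u) (does (u ≟ y)) (does (u ≟ b₁))

  neighbour≢x : ∀ {a} → adj G x a ≡ true → a ≢ x
  neighbour≢x xa a≡x = adj⇒≢ G xa (sym a≡x)

  third-layer : ∀ {w} → Dist G x w 3 → Beyond w
  third-layer xw = (λ w≡x → dist-suc⇒≢ xw (sym w≡x)) , dist-≥2⇒nonadj xw ,
                   λ { refl → case dist-unique xw xy of λ () }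

  x≁y : adj G x y ≡ false
  x≁y = dist-≥2⇒nonadj xy

  x≁b₁ : adj G x b₁ ≡ false
  x≁b₁ = proj₁ (proj₂ (third-layer xb₁))

  classified : ∀ {u} (c : Class u) → tag u ≡ tagOf c
  classified isX rewrite dec-true (x ≟ x) refl = refl
  classified (inA xu) rewrite dec-false (_ ≟ x) (neighbour≢x xu) | xu = refl
  classified isY
    rewrite dec-false (y ≟ x) (λ y≡x → dist-suc⇒≢ xy (sym y≡x)) | x≁y | dec-true (y ≟ y) refl = refl
  classified isB₁ with b₁≢x , _ , b₁≢y ← third-layer xb₁
    rewrite dec-false (b₁ ≟ x) b₁≢x | x≁b₁ | dec-false (b₁ ≟ y) b₁≢y | dec-true (b₁ ≟ b₁) refl = refl
  classified (inB (u≢x , xu , u≢y) u≢b₁)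
    rewrite dec-false (_ ≟ x) u≢x | xu | dec-false (_ ≟ y) u≢y | dec-false (_ ≟ b₁) u≢b₁ = refl

  -- A vertex beyond x, N(x) and y is at distance ≥ 3 from x, hence has no neighbour in N(x).
  A≁beyond : ∀ {a w} → adj G x a ≡ true → Beyond w → adj G a w ≡ false
  A≁beyond {a} {w} xa (w≢x , xw , w≢y) with adj G a w in aw
  ... | false = refl
  ... | true  = ⊥-elim (w≢y (only-y (dist-two xa aw (λ x≡w → w≢x (sym x≡w)) xw)))

  A≁b₁ : ∀ {a} → adj G x a ≡ true → adj G a b₁ ≡ false
  A≁b₁ xa = A≁beyond xa (third-layer xb₁)

  κ : Fin 5 → Fin 5 → Fin 5
  κ X  Y  = # 0
  κ Y  X  = # 0
  κ X  B₁ = # 1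
  κ B₁ X  = # 1
  κ A  B₁ = # 2
  κ B₁ A  = # 2
  κ A  B  = # 3
  κ B  A  = # 3
  κ X  B  = # 4
  κ B  X  = # 4
  κ _  _  = # 0   -- never the colour of an edge on a route

  open Routes G tag κ

  tX : tag x ≡ X
  tX = classified isX

  tY : tag y ≡ Y
  tY = classified isY

  tB₁ : tag b₁ ≡ B₁
  tB₁ = classified isB₁

  betweenNeighbours : ∀ {a a'} → adj G x a ≡ true → adj G x a' ≡ true →
                      RainbowPath (complement G) colouring a a'
  betweenNeighbours {a} {a'} xa xa' with a ≟ a'
  ... | yes refl = trivialPath G
  ... | no a≢a' with b₂ , xb₂ , b₂≢b₁ ← companion xa xa' a≢a' b₁
                   with b₂-beyond@(_ , x≁b₂ , _) ← third-layer xb₂ =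
    loopPath a≢a' (classified (inA xa) ⟨ A≁b₁ xa ⟩ tB₁ ⟨ adj-flip G x≁b₁ ⟩ tX ⟨ x≁b₂ ⟩
                   classified (inB b₂-beyond b₂≢b₁) ⟨ adj-flip G (A≁beyond xa' b₂-beyond) ⟩
                   [ classified (inA xa') ])

  betweenBeyond : ∀ {u v} → Beyond u → u ≢ b₁ → Beyond v → v ≢ b₁ →
                  RainbowPath (complement G) colouring u v
  betweenBeyond {u} {v} bu@(_ , xu , _) u≢b₁ bv v≢b₁ with u ≟ v
  ... | yes refl = trivialPath G
  ... | no u≢v with a₀ , xa₀ ← dist-suc⇒neighbour xb₁ =
    loopPath u≢v (classified (inB bu u≢b₁) ⟨ adj-flip G xu ⟩ tX ⟨ x≁b₁ ⟩ tB₁ ⟨ adj-flip G (A≁b₁ xa₀) ⟩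
                  classified (inA xa₀) ⟨ A≁beyond xa₀ bv ⟩ [ classified (inB bv v≢b₁) ])

  rainbowConnected : ∀ u v → RainbowPath (complement G) colouring u v
  rainbowConnected u v with classify u | classify v
  ... | isX | isX = trivialPath G
  ... | isX | d@(inA xv) = routePath (tX ⟨ x≁b₁ ⟩ tB₁ ⟨ adj-flip G (A≁b₁ xv) ⟩ [ classified d ])
  ... | isX | isY = routePath (tX ⟨ x≁y ⟩ [ tY ])
  ... | isX | isB₁ = routePath (tX ⟨ x≁b₁ ⟩ [ tB₁ ])
  ... | isX | d@(inB (_ , xv , _) _) = routePath (tX ⟨ xv ⟩ [ classified d ])
  ... | c@(inA xu) | isX = routePath (classified c ⟨ A≁b₁ xu ⟩ tB₁ ⟨ adj-flip G x≁b₁ ⟩ [ tX ])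
  ... | inA xu | inA xv = betweenNeighbours xu xv
  ... | c@(inA xu) | isY =
    routePath (classified c ⟨ A≁b₁ xu ⟩ tB₁ ⟨ adj-flip G x≁b₁ ⟩ tX ⟨ x≁y ⟩ [ tY ])
  ... | c@(inA xu) | isB₁ = routePath (classified c ⟨ A≁b₁ xu ⟩ [ tB₁ ])
  ... | c@(inA xu) | d@(inB bv _) = routePath (classified c ⟨ A≁beyond xu bv ⟩ [ classified d ])
  ... | isY | isX = routePath (tY ⟨ adj-flip G x≁y ⟩ [ tX ])
  ... | isY | d@(inA xv) =
    routePath (tY ⟨ adj-flip G x≁y ⟩ tX ⟨ x≁b₁ ⟩ tB₁ ⟨ adj-flip G (A≁b₁ xv) ⟩ [ classified d ])
  ... | isY | isY = trivialPath G
  ... | isY | isB₁ = routePath (tY ⟨ adj-flip G x≁y ⟩ tX ⟨ x≁b₁ ⟩ [ tB₁ ])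
  ... | isY | d@(inB (_ , xv , _) _) = routePath (tY ⟨ adj-flip G x≁y ⟩ tX ⟨ xv ⟩ [ classified d ])
  ... | isB₁ | isX = routePath (tB₁ ⟨ adj-flip G x≁b₁ ⟩ [ tX ])
  ... | isB₁ | d@(inA xv) = routePath (tB₁ ⟨ adj-flip G (A≁b₁ xv) ⟩ [ classified d ])
  ... | isB₁ | isY = routePath (tB₁ ⟨ adj-flip G x≁b₁ ⟩ tX ⟨ x≁y ⟩ [ tY ])
  ... | isB₁ | isB₁ = trivialPath G
  ... | isB₁ | d@(inB (_ , xv , _) _) =
    routePath (tB₁ ⟨ adj-flip G x≁b₁ ⟩ tX ⟨ xv ⟩ [ classified d ])
  ... | c@(inB (_ , xu , _) _) | isX = routePath (classified c ⟨ adj-flip G xu ⟩ [ tX ])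
  ... | c@(inB bu _) | d@(inA xv) =
    routePath (classified c ⟨ adj-flip G (A≁beyond xv bu) ⟩ [ classified d ])
  ... | c@(inB (_ , xu , _) _) | isY = routePath (classified c ⟨ adj-flip G xu ⟩ tX ⟨ x≁y ⟩ [ tY ])
  ... | c@(inB (_ , xu , _) _) | isB₁ =
    routePath (classified c ⟨ adj-flip G xu ⟩ tX ⟨ x≁b₁ ⟩ [ tB₁ ])
  ... | inB bu u≢b₁ | inB bv v≢b₁ = betweenBeyond bu u≢b₁ bv v≢b₁

  rc≤5 : RcAtMost (complement G) 5
  rc≤5 = 5 , ≤-refl , edgeColouring , rainbowConnected

theorem4p1 : ∀ {n : ℕ} (G : Graph n) →
    Connected G → Diam G 3 →
    ((x : Fin n) → Ecc G x 3 →
      ((HasCard (Nbhd G x 1) 1 × HasCard (Nbhd G x 2) 1 × HasCard (Nbhd G x 3) 1)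
        ⊎ (HasCard (Nbhd G x 1) 1 × HasCard (Nbhd G x 2) 1
            × ∃ (λ n₃ → 2 ≤ n₃ × HasCard (Nbhd G x 3) n₃))
        ⊎ (HasCard (Nbhd G x 2) 1
            × ∃ (λ n₁ → 2 ≤ n₁ × HasCard (Nbhd G x 1) n₁)
            × ∃ (λ n₃ → 2 ≤ n₃ × HasCard (Nbhd G x 3) n₃))) →
      RcAtMost (complement G) 5)
    × (TriangleFree G → Connected (complement G) → RcAtMost (complement G) 5)
theorem4p1 G _ (_ , _ , _ , xz) =
  (λ { _ ecc (inj₁ (N₁ , N₂ , _))        → viaSecondNeighbour ecc N₂ (singleNeighbour N₁)
     ; _ ecc (inj₂ (inj₁ (N₁ , N₂ , _))) → viaSecondNeighbour ecc N₂ (singleNeighbour N₁)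
     ; _ ecc (inj₂ (inj₂ (N₂ , _ , _ , 2≤n₃ , N₃))) →
         viaSecondNeighbour ecc N₂ (λ _ _ _ → card-≥2-another 2≤n₃ N₃) }) ,
  λ tf _ → TriangleFreeColouring.rc≤5 G tf xz
  where
  singleNeighbour : ∀ {x} → HasCard (Nbhd G x 1) 1 → FarCompanion G x
  singleNeighbour N₁ xa xa' a≢a' _ = ⊥-elim (a≢a' (card-1-unique N₁ (dist-one xa) (dist-one xa')))

  viaSecondNeighbour : ∀ {x} → Ecc G x 3 → HasCard (Nbhd G x 2) 1 → FarCompanion G x →
                       RcAtMost (complement G) 5
  viaSecondNeighbour (_ , _ , xb₁) N₂ companion with _ , xy ← card-1-witness N₂ =
    UniqueSecondNeighbourColouring.rc≤5 G xy (λ xw → card-1-unique N₂ xw xy) xb₁ companion
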